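{- For each $n\in\mathbb{N}$, the lattice simplex $P_n\subseteq\mathbb{R}^n$ is normal.
   Context: Let $\Omega$ be the $n\times n$ matrix with $(i,j)$-entry $j\binom{i+1}{j+1}$, and let $P_n\subseteq\mathbb{R}^n$ be the convex hull of the $n$ rows of $\Omega$ (an $(n-1)$-dimensional lattice simplex). For a lattice polytope $P\subseteq\mathbb{R}^d$, let $S_P\subseteq\mathbb{Z}^{d+1}$ be the semigroup generated by $\{(1,p): p\in P\cap\mathbb{Z}^d\}$ and $\mathrm{gp}(S_P)$ the group it generates. $P$ is normal if whenever $x\in\mathrm{gp}(S_P)$ and $s\,x\in S_P$ for some positive integer $s$, then $x\in S_P$. -}

module Defs where

open import Data.Nat as ℕ using (ℕ; suc; _≥_)
open import Data.Nat.Combinatorics using (_C_)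
open import Data.Fin using (Fin; zero; suc; toℕ)
open import Data.Integer as ℤ using (ℤ; +_)
open import Data.Rational as ℚ using (ℚ; 0ℚ; 1ℚ)
open import Data.Product using (Σ; _×_; ∃)
open import Relation.Binary.PropositionalEquality using (_≡_)

toℚ : ℤ → ℚ
toℚ z = z ℚ./ 1

sumℚ : ∀ {k} → (Fin k → ℚ) → ℚ
sumℚ {ℕ.zero} f = 0ℚ
sumℚ {suc k} f = f zero ℚ.+ sumℚ (λ i → f (suc i))

-- The matrix Ω (0-indexed): Ω i j = j' * C(i'+1, j'+1) with i' = i+1, j' = j+1
Ω : (n : ℕ) → Fin n → Fin n → ℤ
Ω n i j = + (suc (toℕ j) ℕ.* (suc (suc (toℕ i)) C suc (suc (toℕ j))))

-- p ∈ P_n ∩ ℤ^n : p is a convex combination of the rows of Ω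
-- (coefficients may be taken rational: P_n is a rational polytope)
LatticePt : (n : ℕ) → (Fin n → ℤ) → Set
LatticePt n p =
  Σ (Fin n → ℚ) λ c →
    (∀ k → 0ℚ ℚ.≤ c k) ×
    (sumℚ c ≡ 1ℚ) ×
    (∀ j → sumℚ (λ k → c k ℚ.* toℚ (Ω n k j)) ≡ toℚ (p j))

Gen : (n : ℕ) → (Fin (suc n) → ℤ) → Set
Gen n v = (v zero ≡ + 1) × LatticePt n (λ i → v (suc i))

data InSemigroup {d : ℕ} (G : (Fin d → ℤ) → Set) : (Fin d → ℤ) → Set where
  gen : ∀ v → G v → InSemigroup G v
  add : ∀ u v w → InSemigroup G u → InSemigroup G v →
        (∀ i → w i ≡ u i ℤ.+ v i) → InSemigroup G w

data InGroup {d : ℕ} (G : (Fin d → ℤ) → Set) : (Fin d → ℤ) → Set where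
  gen  : ∀ v → G v → InGroup G v
  zro  : ∀ w → (∀ i → w i ≡ + 0) → InGroup G w
  add  : ∀ u v w → InGroup G u → InGroup G v →
         (∀ i → w i ≡ u i ℤ.+ v i) → InGroup G w
  neg  : ∀ u w → InGroup G u → (∀ i → w i ≡ ℤ.- u i) → InGroup G w

Normal : ℕ → Set
Normal n = ∀ (x : Fin (suc n) → ℤ) → InGroup (Gen n) x →
           ∀ (s : ℕ) → s ≥ 1 →
           InSemigroup (Gen n) (λ i → + s ℤ.* x i) →
           InSemigroup (Gen n) x

-- A lattice point x of the cone over P_n is a nonnegative rational combination ∑ a_k (1, Ω_k).
-- Row k of Ω is ∑_{m ≤ k} (m+1) C(m, ·), so summation by parts writes x as (N_0, ∑_k N_k C(k, ·))
-- with N_k = (k+1)(a_k + ⋯ + a_{n-1}).  The matrix C(k, j) is unitriangular, hence the N_k are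
-- natural numbers, and N_k/(k+1) is nonincreasing.  Conversely each such sequence with N_0 = 1
-- gives a lattice point of P_n, and one with N_0 = t+1 splits as min(N_k, (k+1)t) + (N_k ∸ (k+1)t)
-- into sequences of the same kind with N_0 = t and N_0 = 1.  So every lattice point of the cone
-- lies in S_{P_n}.

{-# OPTIONS --safe #-}
module Submission where

open import Defs
open import Algebra.Bundles using (CommutativeMonoid)
open import Data.Nat as ℕ using (ℕ; zero; suc; z≤n; s≤s)
import Data.Nat.Properties as ℕP
import Data.Nat.Tactic.RingSolver as ℕSolver
open import Data.Nat.Combinatorics using (_C_; nCk+nC[k+1]≡[n+1]C[k+1]; nC1≡n; nCn≡1; k>n⇒nCk≡0)
open import Data.Fin using (Fin; zero; suc; toℕ; fromℕ<)
import Data.Fin.Properties as FinP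
open import Data.Integer as ℤ using (ℤ; +_; +[1+_]; -[1+_])
import Data.Integer.Properties as ℤP
import Data.Integer.Tactic.RingSolver as ℤSolver
open import Data.Rational as ℚ using (ℚ; 0ℚ; 1ℚ)
import Data.Rational.Properties as ℚP
import Data.Rational.Unnormalised as ℚᵘ
import Data.Rational.Unnormalised.Properties as ℚᵘP
open import Data.Rational.Solver using (module +-*-Solver)
open import Data.Product using (∃; _,_; proj₁; proj₂)
open import Function using (_∘_)
open import Relation.Binary.PropositionalEquality
  using (_≡_; refl; sym; trans; cong; cong₂; subst; subst₂; _≗_; module ≡-Reasoning)
open import Relation.Nullary using (yes; no; contradiction)

open +-*-Solver using (solve; _:=_; _:+_; _:*_; _:-_; :-_)

fromℚᵘ-+ : ∀ p q → ℚ.fromℚᵘ (p ℚᵘ.+ q) ≡ ℚ.fromℚᵘ p ℚ.+ ℚ.fromℚᵘ q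
fromℚᵘ-+ p q = ℚP.toℚᵘ-injective (ℚᵘP.≃-trans (ℚP.toℚᵘ-fromℚᵘ (p ℚᵘ.+ q)) (ℚᵘP.≃-sym (ℚᵘP.≃-trans
  (ℚP.toℚᵘ-homo-+ (ℚ.fromℚᵘ p) (ℚ.fromℚᵘ q)) (ℚᵘP.+-cong (ℚP.toℚᵘ-fromℚᵘ p) (ℚP.toℚᵘ-fromℚᵘ q)))))

fromℚᵘ-* : ∀ p q → ℚ.fromℚᵘ (p ℚᵘ.* q) ≡ ℚ.fromℚᵘ p ℚ.* ℚ.fromℚᵘ q
fromℚᵘ-* p q = ℚP.toℚᵘ-injective (ℚᵘP.≃-trans (ℚP.toℚᵘ-fromℚᵘ (p ℚᵘ.* q)) (ℚᵘP.≃-sym (ℚᵘP.≃-trans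
  (ℚP.toℚᵘ-homo-* (ℚ.fromℚᵘ p) (ℚ.fromℚᵘ q)) (ℚᵘP.*-cong (ℚP.toℚᵘ-fromℚᵘ p) (ℚP.toℚᵘ-fromℚᵘ q)))))

toℚ-+ : ∀ a b → toℚ (a ℤ.+ b) ≡ toℚ a ℚ.+ toℚ b
toℚ-+ a b = trans
  (ℚP.fromℚᵘ-cong {ℚᵘ.mkℚᵘ (a ℤ.+ b) 0} {ℚᵘ.mkℚᵘ a 0 ℚᵘ.+ ℚᵘ.mkℚᵘ b 0} (ℚᵘ.*≡* (denominators-one a b)))
  (fromℚᵘ-+ (ℚᵘ.mkℚᵘ a 0) (ℚᵘ.mkℚᵘ b 0))
  where
  denominators-one : ∀ a b → (a ℤ.+ b) ℤ.* + 1 ≡ (a ℤ.* + 1 ℤ.+ b ℤ.* + 1) ℤ.* + 1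
  denominators-one = ℤSolver.solve-∀

toℚ-* : ∀ a b → toℚ (a ℤ.* b) ≡ toℚ a ℚ.* toℚ b
toℚ-* a b = fromℚᵘ-* (ℚᵘ.mkℚᵘ a 0) (ℚᵘ.mkℚᵘ b 0)

toℚ-neg : ∀ a → toℚ (ℤ.- a) ≡ ℚ.- toℚ a
toℚ-neg (+ zero) = refl
toℚ-neg +[1+ m ] = refl
toℚ-neg -[1+ m ] = solve 1 (λ p → p := :- (:- p)) refl (toℚ (+ suc m))

toℚ-pos-* : ∀ m n → toℚ (+ (m ℕ.* n)) ≡ toℚ (+ m) ℚ.* toℚ (+ n)
toℚ-pos-* m n = trans (cong toℚ (ℤP.pos-* m n)) (toℚ-* (+ m) (+ n))

toℚ-mono-≤ : ∀ {a b} → a ℤ.≤ b → toℚ a ℚ.≤ toℚ b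
toℚ-mono-≤ {a} {b} a≤b = ℚP.toℚᵘ-cancel-≤ (ℚᵘP.≤-respʳ-≃ (ℚᵘP.≃-sym (ℚP.toℚᵘ-fromℚᵘ (ℚᵘ.mkℚᵘ b 0)))
  (ℚᵘP.≤-respˡ-≃ (ℚᵘP.≃-sym (ℚP.toℚᵘ-fromℚᵘ (ℚᵘ.mkℚᵘ a 0))) (ℚᵘ.*≤* (ℤP.*-monoʳ-≤-nonNeg (+ 1) a≤b))))

toℚ-pos-nonNeg : ∀ m → 0ℚ ℚ.≤ toℚ (+ m)
toℚ-pos-nonNeg m = toℚ-mono-≤ {+ 0} {+ m} (ℤ.+≤+ z≤n)

toℚ-cancel-≤ : ∀ {a b} → toℚ a ℚ.≤ toℚ b → a ℤ.≤ b
toℚ-cancel-≤ {a} {b} p with ℚᵘP.≤-respʳ-≃ (ℚP.toℚᵘ-fromℚᵘ (ℚᵘ.mkℚᵘ b 0))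
                             (ℚᵘP.≤-respˡ-≃ (ℚP.toℚᵘ-fromℚᵘ (ℚᵘ.mkℚᵘ a 0)) (ℚP.toℚᵘ-mono-≤ p))
... | ℚᵘ.*≤* q = subst₂ ℤ._≤_ (ℤP.*-identityʳ a) (ℤP.*-identityʳ b) q

toℚ-injective : ∀ {a b} → toℚ a ≡ toℚ b → a ≡ b
toℚ-injective e = ℤP.≤-antisym (toℚ-cancel-≤ (ℚP.≤-reflexive e)) (toℚ-cancel-≤ (ℚP.≤-reflexive (sym e)))

IsInteger : ℚ → Set
IsInteger q = ∃ λ z → q ≡ toℚ z

IsInteger-+ : ∀ {p q} → IsInteger p → IsInteger q → IsInteger (p ℚ.+ q)
IsInteger-+ (a , refl) (b , refl) = a ℤ.+ b , sym (toℚ-+ a b)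

IsInteger-- : ∀ {p q} → IsInteger p → IsInteger q → IsInteger (p ℚ.- q)
IsInteger-- (a , refl) (b , refl) = a ℤ.- b , sym (trans (toℚ-+ a (ℤ.- b)) (cong (toℚ a ℚ.+_) (toℚ-neg b)))

IsInteger-* : ∀ {p q} → IsInteger p → IsInteger q → IsInteger (p ℚ.* q)
IsInteger-* (a , refl) (b , refl) = a ℤ.* b , sym (toℚ-* a b)

nonNegative-integer⇒natural : ∀ {q} → IsInteger q → 0ℚ ℚ.≤ q → ∃ λ m → q ≡ toℚ (+ m)
nonNegative-integer⇒natural (a , refl) 0≤a = ℤ.∣ a ∣ , cong toℚ (sym (ℤP.0≤i⇒+∣i∣≡i {a} (toℚ-cancel-≤ {+ 0} {a} 0≤a)))

module RangeSum {c ℓ} (M : CommutativeMonoid c ℓ) where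
  open CommutativeMonoid M
    using (Carrier; _≈_)
    renaming (_∙_ to _+_; ε to 0#; ∙-cong to +-cong; ∙-congˡ to +-congˡ; identityˡ to +-identityˡ;
              identityʳ to +-identityʳ; assoc to +-assoc; refl to ≈-refl; sym to ≈-sym; trans to ≈-trans)
  open import Relation.Binary.Reasoning.Setoid (CommutativeMonoid.setoid M)
  open import Algebra.Solver.CommutativeMonoid M using (_⊕_; _⊜_) renaming (solve to solve-+)

  ∑< : ℕ → (ℕ → Carrier) → Carrier
  ∑< zero    f = 0#
  ∑< (suc n) f = f 0 + ∑< n (f ∘ suc)

  syntax ∑< n (λ k → e) = ∑[ k < n ] e

  ∑-cong : ∀ n {f g} → (∀ k → k ℕ.< n → f k ≈ g k) → ∑< n f ≈ ∑< n g
  ∑-cong zero    f≈g = ≈-refl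
  ∑-cong (suc n) f≈g = +-cong (f≈g 0 (s≤s z≤n)) (∑-cong n (λ k k<n → f≈g (suc k) (s≤s k<n)))

  ∑-distrib-+ : ∀ n f g → ∑[ k < n ] (f k + g k) ≈ ∑< n f + ∑< n g
  ∑-distrib-+ zero    f g = ≈-sym (+-identityˡ 0#)
  ∑-distrib-+ (suc n) f g = begin
    (f 0 + g 0) + ∑[ k < n ] (f (suc k) + g (suc k)) ≈⟨ +-congˡ (∑-distrib-+ n (f ∘ suc) (g ∘ suc)) ⟩
    (f 0 + g 0) + (∑< n (f ∘ suc) + ∑< n (g ∘ suc))   ≈⟨ solve-+ 4 (λ a b c d → (a ⊕ b) ⊕ (c ⊕ d) ⊜ (a ⊕ c) ⊕ (b ⊕ d))
                                                           ≈-refl (f 0) (g 0) (∑< n (f ∘ suc)) (∑< n (g ∘ suc)) ⟩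
    (f 0 + ∑< n (f ∘ suc)) + (g 0 + ∑< n (g ∘ suc))   ∎

  ∑-last : ∀ n f → ∑< (suc n) f ≈ ∑< n f + f n
  ∑-last zero    f = ≈-trans (+-identityʳ (f 0)) (≈-sym (+-identityˡ (f 0)))
  ∑-last (suc n) f = ≈-trans (+-congˡ (∑-last n (f ∘ suc))) (≈-sym (+-assoc (f 0) _ _))

  ∑-split : ∀ m n f → ∑< (m ℕ.+ n) f ≈ ∑< m f + ∑[ i < n ] f (m ℕ.+ i)
  ∑-split zero    n f = ≈-sym (+-identityˡ _)
  ∑-split (suc m) n f = ≈-trans (+-congˡ (∑-split m n (f ∘ suc))) (≈-sym (+-assoc (f 0) _ _))

  ∑-zero : ∀ n f → (∀ k → k ℕ.< n → f k ≈ 0#) → ∑< n f ≈ 0#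
  ∑-zero n f f≈0 = ≈-trans (∑-cong n f≈0) (zeros n)
    where
    zeros : ∀ n → ∑[ k < n ] 0# ≈ 0#
    zeros zero    = ≈-refl
    zeros (suc n) = ≈-trans (+-identityˡ _) (zeros n)

module ℕ∑ = RangeSum ℕP.+-0-commutativeMonoid
open RangeSum ℚP.+-0-commutativeMonoid

sumℚ≡∑ : ∀ n (f : Fin n → ℚ) (g : ℕ → ℚ) → (∀ i → f i ≡ g (toℕ i)) → sumℚ f ≡ ∑< n g
sumℚ≡∑ zero    f g f≡g = refl
sumℚ≡∑ (suc n) f g f≡g = cong₂ ℚ._+_ (f≡g zero) (sumℚ≡∑ n (f ∘ suc) (g ∘ suc) (f≡g ∘ suc))

toℚ-∑ : ∀ n (h : ℕ → ℕ) → toℚ (+ ℕ∑.∑< n h) ≡ ∑[ k < n ] toℚ (+ h k)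
toℚ-∑ zero    h = refl
toℚ-∑ (suc n) h = trans (toℚ-+ (+ h 0) (+ ℕ∑.∑< n (h ∘ suc))) (cong (toℚ (+ h 0) ℚ.+_) (toℚ-∑ n (h ∘ suc)))

IsInteger-∑ : ∀ n f → (∀ k → k ℕ.< n → IsInteger (f k)) → IsInteger (∑< n f)
IsInteger-∑ zero    f int = + 0 , refl
IsInteger-∑ (suc n) f int = IsInteger-+ (int 0 (s≤s z≤n)) (IsInteger-∑ n (f ∘ suc) (λ k k<n → int (suc k) (s≤s k<n)))

∑-nonNeg : ∀ n f → (∀ k → 0ℚ ℚ.≤ f k) → 0ℚ ℚ.≤ ∑< n f
∑-nonNeg zero    f 0≤f = ℚP.≤-refl
∑-nonNeg (suc n) f 0≤f = ℚP.+-mono-≤ (0≤f 0) (∑-nonNeg n (f ∘ suc) (0≤f ∘ suc))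

∑-*ʳ : ∀ n f r → ∑[ k < n ] (f k ℚ.* r) ≡ ∑< n f ℚ.* r
∑-*ʳ zero    f r = sym (ℚP.*-zeroˡ r)
∑-*ʳ (suc n) f r = trans (cong (f 0 ℚ.* r ℚ.+_) (∑-*ʳ n (f ∘ suc) r)) (sym (ℚP.*-distribʳ-+ r (f 0) _))

∑-telescope : ∀ n (T : ℕ → ℚ) → ∑[ k < n ] (T k ℚ.- T (suc k)) ≡ T 0 ℚ.- T n
∑-telescope zero    T = sym (ℚP.+-inverseʳ (T 0))
∑-telescope (suc n) T = trans (cong ((T 0 ℚ.- T 1) ℚ.+_) (∑-telescope n (T ∘ suc)))
  (solve 3 (λ a b c → (a :- b) :+ (b :- c) := a :- c) refl (T 0) (T 1) (T (suc n)))

∑-by-parts : ∀ n (T D : ℕ → ℚ) →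
  ∑[ k < n ] ((T k ℚ.- T (suc k)) ℚ.* ∑< (suc k) D) ℚ.+ T n ℚ.* ∑< n D ≡ ∑[ k < n ] (T k ℚ.* D k)
∑-by-parts zero    T D = trans (ℚP.+-identityˡ _) (ℚP.*-zeroʳ (T 0))
∑-by-parts (suc n) T D = begin
  ∑< (suc n) F ℚ.+ T (suc n) ℚ.* ∑< (suc n) D
    ≡⟨ cong₂ (λ u v → u ℚ.+ T (suc n) ℚ.* v) (∑-last n F) (∑-last n D) ⟩
  (∑< n F ℚ.+ (T n ℚ.- T (suc n)) ℚ.* ∑< (suc n) D) ℚ.+ T (suc n) ℚ.* (∑< n D ℚ.+ D n)
    ≡⟨ cong (λ v → (∑< n F ℚ.+ (T n ℚ.- T (suc n)) ℚ.* v) ℚ.+ T (suc n) ℚ.* (∑< n D ℚ.+ D n)) (∑-last n D) ⟩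
  (∑< n F ℚ.+ (T n ℚ.- T (suc n)) ℚ.* (∑< n D ℚ.+ D n)) ℚ.+ T (suc n) ℚ.* (∑< n D ℚ.+ D n)
    ≡⟨ solve 5 (λ f a b s d → (f :+ (a :- b) :* (s :+ d)) :+ b :* (s :+ d) := (f :+ a :* s) :+ a :* d)
         refl (∑< n F) (T n) (T (suc n)) (∑< n D) (D n) ⟩
  (∑< n F ℚ.+ T n ℚ.* ∑< n D) ℚ.+ T n ℚ.* D n
    ≡⟨ cong (ℚ._+ T n ℚ.* D n) (∑-by-parts n T D) ⟩
  ∑< n (λ k → T k ℚ.* D k) ℚ.+ T n ℚ.* D n
    ≡⟨ ∑-last n (λ k → T k ℚ.* D k) ⟨
  ∑< (suc n) (λ k → T k ℚ.* D k) ∎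
  where
  open ≡-Reasoning
  F : ℕ → ℚ
  F k = (T k ℚ.- T (suc k)) ℚ.* ∑< (suc k) D

*-nonNeg : ∀ {p q} → 0ℚ ℚ.≤ p → 0ℚ ℚ.≤ q → 0ℚ ℚ.≤ p ℚ.* q
*-nonNeg {p} {q} 0≤p 0≤q =
  ℚP.nonNegative⁻¹ _ {{ℚP.nonNeg*nonNeg⇒nonNeg p {{ℚ.nonNegative 0≤p}} q {{ℚ.nonNegative 0≤q}}}}

p≤q⇒0≤q-p : ∀ {p q} → p ℚ.≤ q → 0ℚ ℚ.≤ q ℚ.- p
p≤q⇒0≤q-p {p} {q} p≤q = subst (ℚ._≤ q ℚ.- p) (ℚP.+-inverseʳ p) (ℚP.+-monoˡ-≤ (ℚ.- p) p≤q)

1/[1+_] : ℕ → ℚ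
1/[1+ k ] = + 1 ℚ./ suc k

1/[1+]-nonNeg : ∀ k → 0ℚ ℚ.≤ 1/[1+ k ]
1/[1+]-nonNeg k = ℚP.nonNegative⁻¹ _ {{ℚP.normalize-nonNeg 1 (suc k)}}

*-1/[1+] : ∀ k → toℚ (+ suc k) ℚ.* 1/[1+ k ] ≡ 1ℚ
*-1/[1+] k = trans (sym (fromℚᵘ-* (ℚᵘ.mkℚᵘ (+ suc k) 0) (ℚᵘ.mkℚᵘ (+ 1) k)))
  (ℚP.fromℚᵘ-cong {ℚᵘ.mkℚᵘ (+ suc k) 0 ℚᵘ.* ℚᵘ.mkℚᵘ (+ 1) k} {ℚᵘ.mkℚᵘ (+ 1) 0}
    (ℚᵘ.*≡* (cong (λ m → + suc m) (cross-multiplied k))))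
  where
  cross-multiplied : ∀ k → k ℕ.* 1 ℕ.* 1 ≡ k ℕ.+ 0 ℕ.* suc k ℕ.+ 0 ℕ.* suc (k ℕ.+ 0 ℕ.* suc k)
  cross-multiplied = ℕSolver.solve-∀

cancel-1/[1+] : ∀ k q → toℚ (+ suc k) ℚ.* (q ℚ.* 1/[1+ k ]) ≡ q
cancel-1/[1+] k q = begin
  s ℚ.* (q ℚ.* 1/[1+ k ]) ≡⟨ solve 3 (λ s q r → s :* (q :* r) := q :* (s :* r)) refl s q 1/[1+ k ] ⟩
  q ℚ.* (s ℚ.* 1/[1+ k ]) ≡⟨ cong (q ℚ.*_) (*-1/[1+] k) ⟩
  q ℚ.* 1ℚ                ≡⟨ ℚP.*-identityʳ q ⟩
  q                       ∎
  where
  open ≡-Reasoning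
  s = toℚ (+ suc k)

cross-≤⇒*-1/[1+]-≤ : ∀ a b p q → suc q ℕ.* a ℕ.≤ suc p ℕ.* b → toℚ (+ a) ℚ.* 1/[1+ p ] ℚ.≤ toℚ (+ b) ℚ.* 1/[1+ q ]
cross-≤⇒*-1/[1+]-≤ a b p q cross-≤ =
  subst₂ ℚ._≤_ (fromℚᵘ-* (ℚᵘ.mkℚᵘ (+ a) 0) (ℚᵘ.mkℚᵘ (+ 1) p)) (fromℚᵘ-* (ℚᵘ.mkℚᵘ (+ b) 0) (ℚᵘ.mkℚᵘ (+ 1) q))
    (ℚP.toℚᵘ-cancel-≤ (ℚᵘP.≤-respʳ-≃ (ℚᵘP.≃-sym (ℚP.toℚᵘ-fromℚᵘ (X b q)))
      (ℚᵘP.≤-respˡ-≃ (ℚᵘP.≃-sym (ℚP.toℚᵘ-fromℚᵘ (X a p)))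
        (ℚᵘ.*≤* (subst₂ ℤ._≤_ (numerator a p b q) (numerator b q a p) (ℤ.+≤+ cross-≤))))))
  where
  X : ℕ → ℕ → ℚᵘ.ℚᵘ
  X a p = ℚᵘ.mkℚᵘ (+ a) 0 ℚᵘ.* ℚᵘ.mkℚᵘ (+ 1) p
  numerator : ∀ a p b q → + (suc q ℕ.* a) ≡ ℚᵘ.↥ (X a p) ℤ.* ℚᵘ.↧ (X b q)
  numerator a p b q = trans (cong +_ (ℕP.*-comm (suc q) a)) (trans (ℤP.pos-* a (suc q))
    (cong₂ ℤ._*_ (sym (ℤP.*-identityʳ (+ a))) (cong +_ (sym (ℕP.*-identityˡ (suc q))))))

absorption : ∀ m j → suc j ℕ.* (suc m C suc j) ≡ suc m ℕ.* (m C j)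
absorption zero    zero    = refl
absorption zero    (suc j) = ℕP.*-zeroʳ (suc (suc j))
absorption (suc m) zero    = trans (ℕP.*-identityˡ _) (trans (nC1≡n (suc (suc m))) (sym (ℕP.*-identityʳ _)))
absorption (suc m) (suc j) = begin
  suc (suc j) ℕ.* (suc (suc m) C suc (suc j))
    ≡⟨ cong (suc (suc j) ℕ.*_) (nCk+nC[k+1]≡[n+1]C[k+1] (suc m) (suc j)) ⟨
  suc (suc j) ℕ.* ((suc m C suc j) ℕ.+ (suc m C suc (suc j)))
    ≡⟨ expand j (suc m C suc j) (suc m C suc (suc j)) ⟩
  suc j ℕ.* (suc m C suc j) ℕ.+ (suc m C suc j) ℕ.+ suc (suc j) ℕ.* (suc m C suc (suc j))
    ≡⟨ cong₂ (λ u v → u ℕ.+ (suc m C suc j) ℕ.+ v) (absorption m j) (absorption m (suc j)) ⟩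
  suc m ℕ.* (m C j) ℕ.+ (suc m C suc j) ℕ.+ suc m ℕ.* (m C suc j)
    ≡⟨ cong (λ u → suc m ℕ.* (m C j) ℕ.+ u ℕ.+ suc m ℕ.* (m C suc j)) (nCk+nC[k+1]≡[n+1]C[k+1] m j) ⟨
  suc m ℕ.* (m C j) ℕ.+ ((m C j) ℕ.+ (m C suc j)) ℕ.+ suc m ℕ.* (m C suc j)
    ≡⟨ collect m (m C j) (m C suc j) ⟩
  suc (suc m) ℕ.* ((m C j) ℕ.+ (m C suc j))
    ≡⟨ cong (suc (suc m) ℕ.*_) (nCk+nC[k+1]≡[n+1]C[k+1] m j) ⟩
  suc (suc m) ℕ.* (suc m C suc j) ∎
  where
  open ≡-Reasoning
  expand : ∀ j a b → suc (suc j) ℕ.* (a ℕ.+ b) ≡ suc j ℕ.* a ℕ.+ a ℕ.+ suc (suc j) ℕ.* b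
  expand = ℕSolver.solve-∀
  collect : ∀ m a b → suc m ℕ.* a ℕ.+ (a ℕ.+ b) ℕ.+ suc m ℕ.* b ≡ suc (suc m) ℕ.* (a ℕ.+ b)
  collect = ℕSolver.solve-∀

-- Ω n i j is + ω (toℕ i) (toℕ j) definitionally.
ω : ℕ → ℕ → ℕ
ω k j = suc j ℕ.* (suc (suc k) C suc (suc j))

ω-as-sum : ∀ k j → ω k j ≡ ℕ∑.∑< (suc k) (λ m → suc m ℕ.* (m C j))
ω-as-sum zero    zero    = refl
ω-as-sum zero    (suc j) = ℕP.*-zeroʳ (suc (suc j))
ω-as-sum (suc k) j = begin
  suc j ℕ.* (suc (suc (suc k)) C suc (suc j))
    ≡⟨ cong (suc j ℕ.*_) (nCk+nC[k+1]≡[n+1]C[k+1] (suc (suc k)) (suc j)) ⟨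
  suc j ℕ.* ((suc (suc k) C suc j) ℕ.+ (suc (suc k) C suc (suc j)))
    ≡⟨ ℕP.*-distribˡ-+ (suc j) (suc (suc k) C suc j) (suc (suc k) C suc (suc j)) ⟩
  suc j ℕ.* (suc (suc k) C suc j) ℕ.+ ω k j
    ≡⟨ cong₂ ℕ._+_ (absorption (suc k) j) (ω-as-sum k j) ⟩
  suc (suc k) ℕ.* (suc k C j) ℕ.+ ℕ∑.∑< (suc k) D
    ≡⟨ ℕP.+-comm _ (ℕ∑.∑< (suc k) D) ⟩
  ℕ∑.∑< (suc k) D ℕ.+ D (suc k)
    ≡⟨ ℕ∑.∑-last (suc k) D ⟨
  ℕ∑.∑< (suc (suc k)) D ∎
  where
  open ≡-Reasoning
  D : ℕ → ℕ
  D m = suc m ℕ.* (m C j)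

binomialTransform : ℕ → (ℕ → ℚ) → ℕ → ℚ
binomialTransform n L j = ∑[ k < n ] (L k ℚ.* toℚ (+ (k C j)))

binomialTransform-cong : ∀ n {L L′} → (∀ k → L k ≡ L′ k) → ∀ j → binomialTransform n L j ≡ binomialTransform n L′ j
binomialTransform-cong n L≡L′ j = ∑-cong n (λ k _ → cong (ℚ._* toℚ (+ (k C j))) (L≡L′ k))

differences-ω≡binomialTransform : ∀ n (T : ℕ → ℚ) j → T n ≡ 0ℚ →
  ∑[ k < n ] ((T k ℚ.- T (suc k)) ℚ.* toℚ (+ ω k j)) ≡ binomialTransform n (λ k → toℚ (+ suc k) ℚ.* T k) j
differences-ω≡binomialTransform n T j Tn≡0 = begin
  ∑[ k < n ] ((T k ℚ.- T (suc k)) ℚ.* toℚ (+ ω k j))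
    ≡⟨ ∑-cong n (λ k _ → cong ((T k ℚ.- T (suc k)) ℚ.*_) (trans (cong (toℚ ∘ +_) (ω-as-sum k j)) (toℚ-∑ (suc k) (λ m → suc m ℕ.* (m C j))))) ⟩
  ∑[ k < n ] ((T k ℚ.- T (suc k)) ℚ.* ∑< (suc k) D)
    ≡⟨ ℚP.+-identityʳ _ ⟨
  ∑[ k < n ] ((T k ℚ.- T (suc k)) ℚ.* ∑< (suc k) D) ℚ.+ 0ℚ
    ≡⟨ cong (∑[ k < n ] ((T k ℚ.- T (suc k)) ℚ.* ∑< (suc k) D) ℚ.+_)
         (trans (cong (ℚ._* ∑< n D) Tn≡0) (ℚP.*-zeroˡ (∑< n D))) ⟨
  ∑[ k < n ] ((T k ℚ.- T (suc k)) ℚ.* ∑< (suc k) D) ℚ.+ T n ℚ.* ∑< n D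
    ≡⟨ ∑-by-parts n T D ⟩
  ∑[ k < n ] (T k ℚ.* D k)
    ≡⟨ ∑-cong n (λ k _ → regroup k) ⟩
  binomialTransform n (λ k → toℚ (+ suc k) ℚ.* T k) j ∎
  where
  open ≡-Reasoning
  D : ℕ → ℚ
  D m = toℚ (+ (suc m ℕ.* (m C j)))
  regroup : ∀ k → T k ℚ.* D k ≡ (toℚ (+ suc k) ℚ.* T k) ℚ.* toℚ (+ (k C j))
  regroup k = trans (cong (T k ℚ.*_) (toℚ-pos-* (suc k) (k C j)))
    (solve 3 (λ t s c → t :* (s :* c) := (s :* t) :* c) refl (T k) (toℚ (+ suc k)) (toℚ (+ (k C j))))

record Admissible (n : ℕ) (N : ℕ → ℕ) : Set where
  field
    ratio-antitone : ∀ k → suc k ℕ.* N (suc k) ℕ.≤ suc (suc k) ℕ.* N k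
    vanishes       : ∀ k → n ℕ.≤ k → N k ≡ 0

point : (n : ℕ) → (ℕ → ℕ) → Fin (suc n) → ℤ
point n N zero    = + N 0
point n N (suc j) = + ℕ∑.∑< n (λ k → N k ℕ.* (k C toℕ j))

toℚ-point : ∀ n N j → toℚ (point n N (suc j)) ≡ binomialTransform n (λ k → toℚ (+ N k)) (toℕ j)
toℚ-point n N j = trans (toℚ-∑ n _) (∑-cong n (λ k _ → toℚ-pos-* (N k) (k C toℕ j)))

point-split : ∀ n {N A B} → (∀ k → N k ≡ A k ℕ.+ B k) → ∀ i → point n N i ≡ point n A i ℤ.+ point n B i
point-split n N≡A+B zero    = cong +_ (N≡A+B 0)
point-split n {N} {A} {B} N≡A+B (suc j) = cong +_ (trans
  (ℕ∑.∑-cong n (λ k _ → trans (cong (ℕ._* (k C toℕ j)) (N≡A+B k)) (ℕP.*-distribʳ-+ (k C toℕ j) (A k) (B k))))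
  (ℕ∑.∑-distrib-+ n (λ k → A k ℕ.* (k C toℕ j)) (λ k → B k ℕ.* (k C toℕ j))))

linear-ratio : ∀ k u → suc k ℕ.* (suc (suc k) ℕ.* u) ≡ suc (suc k) ℕ.* (suc k ℕ.* u)
linear-ratio = ℕSolver.solve-∀

-- The sequence k ↦ (k+1) u has constant ratio, so cutting N along it preserves admissibility.
module _ {n N} (adm : Admissible n N) (u : ℕ) where
  open Admissible adm

  Admissible-⊓ : Admissible n (λ k → (suc k ℕ.* u) ℕ.⊓ N k)
  Admissible-⊓ = record
    { ratio-antitone = λ k → subst₂ ℕ._≤_
        (sym (ℕP.*-distribˡ-⊓ (suc k) (suc (suc k) ℕ.* u) (N (suc k))))
        (sym (ℕP.*-distribˡ-⊓ (suc (suc k)) (suc k ℕ.* u) (N k)))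
        (ℕP.⊓-mono-≤ (ℕP.≤-reflexive (linear-ratio k u)) (ratio-antitone k))
    ; vanishes = λ k n≤k → trans (cong ((suc k ℕ.* u) ℕ.⊓_) (vanishes k n≤k)) (ℕP.⊓-zeroʳ _)
    }

  Admissible-∸ : Admissible n (λ k → N k ℕ.∸ (suc k ℕ.* u))
  Admissible-∸ = record
    { ratio-antitone = λ k → subst₂ ℕ._≤_
        (sym (ℕP.*-distribˡ-∸ (suc k) (N (suc k)) (suc (suc k) ℕ.* u)))
        (sym (ℕP.*-distribˡ-∸ (suc (suc k)) (N k) (suc k ℕ.* u)))
        (ℕP.∸-mono (ratio-antitone k) (ℕP.≤-reflexive (sym (linear-ratio k u))))
    ; vanishes = λ k n≤k → trans (cong (ℕ._∸ (suc k ℕ.* u)) (vanishes k n≤k)) (ℕP.0∸n≡0 (suc k ℕ.* u))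
    }

point-gen : ∀ {n N x} → Admissible n N → N 0 ≡ 1 → x ≗ point n N → Gen n x
point-gen {n} {N} {x} adm N0≡1 x≗N = trans (x≗N zero) (cong +_ N0≡1) , c , c-nonNeg , c-sum , c-rows
  where
  open Admissible adm
  T : ℕ → ℚ
  T k = toℚ (+ N k) ℚ.* 1/[1+ k ]
  T0≡1 : T 0 ≡ 1ℚ
  T0≡1 = cong (λ m → toℚ (+ m) ℚ.* 1/[1+ 0 ]) N0≡1
  Tn≡0 : T n ≡ 0ℚ
  Tn≡0 = trans (cong (λ m → toℚ (+ m) ℚ.* 1/[1+ n ]) (vanishes n ℕP.≤-refl)) (ℚP.*-zeroˡ 1/[1+ n ])
  c : Fin n → ℚ
  c i = T (toℕ i) ℚ.- T (suc (toℕ i))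
  c-nonNeg : ∀ i → 0ℚ ℚ.≤ c i
  c-nonNeg i = p≤q⇒0≤q-p (cross-≤⇒*-1/[1+]-≤ (N (suc (toℕ i))) (N (toℕ i)) (suc (toℕ i)) (toℕ i) (ratio-antitone (toℕ i)))
  c-sum : sumℚ c ≡ 1ℚ
  c-sum = trans (sumℚ≡∑ n c (λ k → T k ℚ.- T (suc k)) (λ _ → refl))
                (trans (∑-telescope n T) (cong₂ ℚ._-_ T0≡1 Tn≡0))
  c-rows : ∀ j → sumℚ (λ k → c k ℚ.* toℚ (Ω n k j)) ≡ toℚ (x (suc j))
  c-rows j = begin
    sumℚ (λ k → c k ℚ.* toℚ (Ω n k j))
      ≡⟨ sumℚ≡∑ n _ (λ k → (T k ℚ.- T (suc k)) ℚ.* toℚ (+ ω k (toℕ j))) (λ _ → refl) ⟩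
    ∑[ k < n ] ((T k ℚ.- T (suc k)) ℚ.* toℚ (+ ω k (toℕ j)))
      ≡⟨ differences-ω≡binomialTransform n T (toℕ j) Tn≡0 ⟩
    binomialTransform n (λ k → toℚ (+ suc k) ℚ.* T k) (toℕ j)
      ≡⟨ binomialTransform-cong n (λ k → cancel-1/[1+] k (toℚ (+ N k))) (toℕ j) ⟩
    binomialTransform n (λ k → toℚ (+ N k)) (toℕ j)
      ≡⟨ toℚ-point n N j ⟨
    toℚ (point n N (suc j))
      ≡⟨ cong toℚ (x≗N (suc j)) ⟨
    toℚ (x (suc j)) ∎
    where open ≡-Reasoning

point∈S : ∀ {n N x} t → Admissible n N → N 0 ≡ suc t → x ≗ point n N → InSemigroup (Gen n) x
point∈S {x = x} zero adm N0≡1 x≗N = gen x (point-gen adm N0≡1 x≗N)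
point∈S {n} {N} {x} (suc t) adm N0≡2+t x≗N =
  add _ _ x (point∈S t (Admissible-⊓ adm (suc t)) lower0 (λ _ → refl))
            (gen _ (point-gen (Admissible-∸ adm (suc t)) upper0 (λ _ → refl)))
            (λ i → trans (x≗N i) (point-split n (λ k → sym (ℕP.m⊓n+n∸m≡n (suc k ℕ.* suc t) (N k))) i))
  where
  lower0 : (1 ℕ.* suc t) ℕ.⊓ N 0 ≡ suc t
  lower0 = trans (cong₂ ℕ._⊓_ (ℕP.*-identityˡ (suc t)) N0≡2+t) (ℕP.m≤n⇒m⊓n≡m (ℕP.n≤1+n (suc t)))
  upper0 : N 0 ℕ.∸ (1 ℕ.* suc t) ≡ 1
  upper0 = trans (cong₂ ℕ._∸_ N0≡2+t (ℕP.*-identityˡ (suc t))) (ℕP.m+n∸n≡m 1 (suc t))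

record ConeCombination (n : ℕ) (y : Fin (suc n) → ℤ) : Set where
  field
    coeff        : ℕ → ℚ
    coeff-nonNeg : ∀ k → 0ℚ ℚ.≤ coeff k
    height       : ∑< n coeff ≡ toℚ (y zero)
    coordinates  : ∀ j → ∑[ k < n ] (coeff k ℚ.* toℚ (+ ω k (toℕ j))) ≡ toℚ (y (suc j))

extendByZero : ∀ {n} → (Fin n → ℚ) → ℕ → ℚ
extendByZero {zero}  c k       = 0ℚ
extendByZero {suc n} c zero    = c zero
extendByZero {suc n} c (suc k) = extendByZero (c ∘ suc) k

extendByZero-toℕ : ∀ {n} (c : Fin n → ℚ) i → c i ≡ extendByZero c (toℕ i)
extendByZero-toℕ c zero    = refl
extendByZero-toℕ c (suc i) = extendByZero-toℕ (c ∘ suc) i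

extendByZero-nonNeg : ∀ {n} (c : Fin n → ℚ) → (∀ i → 0ℚ ℚ.≤ c i) → ∀ k → 0ℚ ℚ.≤ extendByZero c k
extendByZero-nonNeg {zero}  c 0≤c k       = ℚP.≤-refl
extendByZero-nonNeg {suc n} c 0≤c zero    = 0≤c zero
extendByZero-nonNeg {suc n} c 0≤c (suc k) = extendByZero-nonNeg (c ∘ suc) (0≤c ∘ suc) k

LatticePt⇒ConeCombination : ∀ {n y} → y zero ≡ + 1 → LatticePt n (y ∘ suc) → ConeCombination n y
LatticePt⇒ConeCombination {n} {y} y0≡1 (c , c-nonNeg , c-sum , c-rows) = record
  { coeff        = extendByZero c
  ; coeff-nonNeg = extendByZero-nonNeg c c-nonNeg
  ; height       = trans (sym (sumℚ≡∑ n c _ (extendByZero-toℕ c))) (trans c-sum (cong toℚ (sym y0≡1)))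
  ; coordinates  = λ j → trans
      (sym (sumℚ≡∑ n _ _ (λ i → cong (ℚ._* toℚ (Ω n i j)) (extendByZero-toℕ c i)))) (c-rows j)
  }

ConeCombination-+ : ∀ {n u v w} → (∀ i → w i ≡ u i ℤ.+ v i) →
                    ConeCombination n u → ConeCombination n v → ConeCombination n w
ConeCombination-+ {n} {u} {v} {w} w≡u+v A B = record
  { coeff        = λ k → A.coeff k ℚ.+ B.coeff k
  ; coeff-nonNeg = λ k → ℚP.+-mono-≤ (A.coeff-nonNeg k) (B.coeff-nonNeg k)
  ; height       = trans (∑-distrib-+ n A.coeff B.coeff) (trans (cong₂ ℚ._+_ A.height B.height) (sym (toℚ-w zero)))
  ; coordinates  = λ j → trans (∑-cong n (λ k _ → ℚP.*-distribʳ-+ (toℚ (+ ω k (toℕ j))) (A.coeff k) (B.coeff k)))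
      (trans (∑-distrib-+ n _ _) (trans (cong₂ ℚ._+_ (A.coordinates j) (B.coordinates j)) (sym (toℚ-w (suc j)))))
  }
  where
  module A = ConeCombination A
  module B = ConeCombination B
  toℚ-w : ∀ i → toℚ (w i) ≡ toℚ (u i) ℚ.+ toℚ (v i)
  toℚ-w i = trans (cong toℚ (w≡u+v i)) (toℚ-+ (u i) (v i))

semigroup⇒ConeCombination : ∀ {n y} → InSemigroup (Gen n) y → ConeCombination n y
semigroup⇒ConeCombination (gen y (y0≡1 , y-in-P)) = LatticePt⇒ConeCombination y0≡1 y-in-P
semigroup⇒ConeCombination (add u v w u∈S v∈S w≡u+v) =
  ConeCombination-+ w≡u+v (semigroup⇒ConeCombination u∈S) (semigroup⇒ConeCombination v∈S)

ConeCombination-unscale : ∀ {n} s {x} → ConeCombination n (λ i → + suc s ℤ.* x i) → ConeCombination n x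
ConeCombination-unscale {n} s {x} cone = record
  { coeff        = λ k → coeff k ℚ.* 1/[1+ s ]
  ; coeff-nonNeg = λ k → *-nonNeg (coeff-nonNeg k) (1/[1+]-nonNeg s)
  ; height       = trans (∑-*ʳ n coeff 1/[1+ s ]) (trans (cong (ℚ._* 1/[1+ s ]) height) (unscale (x zero)))
  ; coordinates  = λ j → trans
      (∑-cong n (λ k _ → solve 3 (λ a r w → (a :* r) :* w := (a :* w) :* r) refl (coeff k) 1/[1+ s ] (toℚ (+ ω k (toℕ j)))))
      (trans (∑-*ʳ n _ 1/[1+ s ]) (trans (cong (ℚ._* 1/[1+ s ]) (coordinates j)) (unscale (x (suc j)))))
  }
  where
  open ConeCombination cone
  unscale : ∀ z → toℚ (+ suc s ℤ.* z) ℚ.* 1/[1+ s ] ≡ toℚ z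
  unscale z = trans (cong (ℚ._* 1/[1+ s ]) (toℚ-* (+ suc s) z))
    (trans (ℚP.*-assoc (toℚ (+ suc s)) (toℚ z) 1/[1+ s ]) (cancel-1/[1+] s (toℚ z)))

semigroup-height : ∀ {n y} → InSemigroup (Gen n) y → ∃ λ m → y zero ≡ + suc m
semigroup-height (gen y (y0≡1 , _)) = 0 , y0≡1
semigroup-height (add u v w u∈S v∈S w≡u+v) with semigroup-height u∈S | semigroup-height v∈S
... | m , u0≡1+m | m′ , v0≡1+m′ = m ℕ.+ suc m′ , trans (w≡u+v zero) (cong₂ ℤ._+_ u0≡1+m v0≡1+m′)

binomialTransform-unitriangular : ∀ n L {k} → k ℕ.< n →
  binomialTransform n L k ≡ L k ℚ.+ ∑[ i < n ℕ.∸ suc k ] (L (k ℕ.+ suc i) ℚ.* toℚ (+ ((k ℕ.+ suc i) C k)))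
binomialTransform-unitriangular n L {k} k<n = begin
  ∑< n f                            ≡⟨ cong (λ m → ∑< m f) (trans (ℕP.+-suc k r) (ℕP.m+[n∸m]≡n k<n)) ⟨
  ∑< (k ℕ.+ suc r) f                ≡⟨ ∑-split k (suc r) f ⟩
  ∑< k f ℚ.+ (f (k ℕ.+ 0) ℚ.+ rest) ≡⟨ cong₂ (λ u v → u ℚ.+ (v ℚ.+ rest)) (∑-zero k f above-diagonal) diagonal ⟩
  0ℚ ℚ.+ (L k ℚ.+ rest)             ≡⟨ ℚP.+-identityˡ _ ⟩
  L k ℚ.+ rest                      ∎
  where
  open ≡-Reasoning
  r = n ℕ.∸ suc k
  f : ℕ → ℚ
  f m = L m ℚ.* toℚ (+ (m C k))
  rest = ∑[ i < r ] f (k ℕ.+ suc i)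
  above-diagonal : ∀ m → m ℕ.< k → f m ≡ 0ℚ
  above-diagonal m m<k = trans (cong (λ c → L m ℚ.* toℚ (+ c)) (k>n⇒nCk≡0 m<k)) (ℚP.*-zeroʳ (L m))
  diagonal : f (k ℕ.+ 0) ≡ L k
  diagonal = trans (cong f (ℕP.+-identityʳ k))
                   (trans (cong (λ c → L k ℚ.* toℚ (+ c)) (nCn≡1 k)) (ℚP.*-identityʳ (L k)))

integral-binomialTransform⇒integral : ∀ n (L : ℕ → ℚ) → (∀ k → n ℕ.≤ k → L k ≡ 0ℚ) →
  (∀ j → j ℕ.< n → IsInteger (binomialTransform n L j)) → ∀ k → IsInteger (L k)
integral-binomialTransform⇒integral n L L-vanishes transform-integral k = from-above n k (ℕP.m≤n+m n k)
  where
  from-above : ∀ d k → n ℕ.≤ k ℕ.+ d → IsInteger (L k)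
  from-above zero    k n≤k+0 = + 0 , L-vanishes k (subst (n ℕ.≤_) (ℕP.+-identityʳ k) n≤k+0)
  from-above (suc d) k n≤k+1+d with n ℕP.≤? k
  ... | yes n≤k = + 0 , L-vanishes k n≤k
  ... | no  n≰k = subst IsInteger (sym L-k≡) (IsInteger-- (transform-integral k k<n) rest-integral)
    where
    k<n = ℕP.≰⇒> n≰k
    r = n ℕ.∸ suc k
    rest = ∑[ i < r ] (L (k ℕ.+ suc i) ℚ.* toℚ (+ ((k ℕ.+ suc i) C k)))
    L-k≡ : L k ≡ binomialTransform n L k ℚ.- rest
    L-k≡ = trans (sym (solve 2 (λ p q → (p :+ q) :- q := p) refl (L k) rest))
                 (cong (ℚ._- rest) (sym (binomialTransform-unitriangular n L k<n)))
    closer : ∀ i → n ℕ.≤ k ℕ.+ suc i ℕ.+ d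
    closer i = ℕP.≤-trans n≤k+1+d (ℕP.≤-trans (ℕP.+-monoʳ-≤ k (s≤s (ℕP.m≤n+m d i)))
                                               (ℕP.≤-reflexive (sym (ℕP.+-assoc k (suc i) d))))
    rest-integral : IsInteger rest
    rest-integral = IsInteger-∑ r _ (λ i _ → IsInteger-* (from-above d (k ℕ.+ suc i) (closer i)) (+ ((k ℕ.+ suc i) C k) , refl))

tailSum : ℕ → (ℕ → ℚ) → ℕ → ℚ
tailSum n a k = ∑[ m < n ℕ.∸ k ] a (k ℕ.+ m)

tailSum-step : ∀ n a {k} → k ℕ.< n → tailSum n a k ≡ a k ℚ.+ tailSum n a (suc k)
tailSum-step n a {k} k<n = trans (cong (λ m → ∑[ i < m ] a (k ℕ.+ i)) (ℕP.+-∸-assoc 1 k<n))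
  (cong₂ ℚ._+_ (cong a (ℕP.+-identityʳ k)) (∑-cong (n ℕ.∸ suc k) (λ m _ → cong a (ℕP.+-suc k m))))

tailSum-vanishes : ∀ n a {k} → n ℕ.≤ k → tailSum n a k ≡ 0ℚ
tailSum-vanishes n a {k} n≤k = cong (λ m → ∑[ i < m ] a (k ℕ.+ i)) (ℕP.m≤n⇒m∸n≡0 n≤k)

tailSum-antitone : ∀ n a → (∀ k → 0ℚ ℚ.≤ a k) → ∀ k → tailSum n a (suc k) ℚ.≤ tailSum n a k
tailSum-antitone n a 0≤a k with k ℕP.<? n
... | yes k<n = subst₂ ℚ._≤_ (ℚP.+-identityˡ _) (sym (tailSum-step n a k<n))
                  (ℚP.+-monoˡ-≤ (tailSum n a (suc k)) (0≤a k))
... | no  k≮n = ℚP.≤-reflexive (trans (tailSum-vanishes n a (ℕP.≤-trans n≤k (ℕP.n≤1+n k)))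
                                      (sym (tailSum-vanishes n a n≤k)))
  where n≤k = ℕP.≮⇒≥ k≮n

module FromCone {n} {x : Fin (suc n) → ℤ} (cone : ConeCombination n x) where
  open ConeCombination cone

  T : ℕ → ℚ
  T = tailSum n coeff

  L : ℕ → ℚ
  L k = toℚ (+ suc k) ℚ.* T k

  L-vanishes : ∀ k → n ℕ.≤ k → L k ≡ 0ℚ
  L-vanishes k n≤k = trans (cong (toℚ (+ suc k) ℚ.*_) (tailSum-vanishes n coeff n≤k)) (ℚP.*-zeroʳ (toℚ (+ suc k)))

  L-height : toℚ (x zero) ≡ L 0
  L-height = trans (sym height) (sym (ℚP.*-identityˡ (T 0)))

  L-coordinates : ∀ j → toℚ (x (suc j)) ≡ binomialTransform n L (toℕ j)
  L-coordinates j = begin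
    toℚ (x (suc j))
      ≡⟨ coordinates j ⟨
    ∑[ k < n ] (coeff k ℚ.* toℚ (+ ω k (toℕ j)))
      ≡⟨ ∑-cong n (λ k k<n → cong (ℚ._* toℚ (+ ω k (toℕ j))) (coeff≡ΔT k<n)) ⟩
    ∑[ k < n ] ((T k ℚ.- T (suc k)) ℚ.* toℚ (+ ω k (toℕ j)))
      ≡⟨ differences-ω≡binomialTransform n T (toℕ j) (tailSum-vanishes n coeff ℕP.≤-refl) ⟩
    binomialTransform n L (toℕ j) ∎
    where
    open ≡-Reasoning
    coeff≡ΔT : ∀ {k} → k ℕ.< n → coeff k ≡ T k ℚ.- T (suc k)
    coeff≡ΔT {k} k<n = trans (sym (solve 2 (λ p q → (p :+ q) :- q := p) refl (coeff k) (T (suc k))))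
                             (cong (ℚ._- T (suc k)) (sym (tailSum-step n coeff k<n)))

  L-natural : ∀ k → ∃ λ m → L k ≡ toℚ (+ m)
  L-natural k = nonNegative-integer⇒natural
    (integral-binomialTransform⇒integral n L L-vanishes transform-integral k)
    (*-nonNeg (toℚ-pos-nonNeg (suc k)) (∑-nonNeg (n ℕ.∸ k) _ (coeff-nonNeg ∘ (k ℕ.+_))))
    where
    transform-integral : ∀ j → j ℕ.< n → IsInteger (binomialTransform n L j)
    transform-integral j j<n = x (suc (fromℕ< j<n)) ,
      sym (trans (L-coordinates (fromℕ< j<n)) (cong (binomialTransform n L) (FinP.toℕ-fromℕ< j<n)))

  N : ℕ → ℕ
  N k = proj₁ (L-natural k)

  toℚ-N : ∀ k → toℚ (+ N k) ≡ L k
  toℚ-N k = sym (proj₂ (L-natural k))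

  admissible : Admissible n N
  admissible = record
    { ratio-antitone = λ k → ℤP.drop‿+≤+ (toℚ-cancel-≤ (subst₂ ℚ._≤_
        (sym (trans (toℚ-pos-* (suc k) (N (suc k))) (cong (toℚ (+ suc k) ℚ.*_) (toℚ-N (suc k)))))
        (sym (trans (toℚ-pos-* (suc (suc k)) (N k)) (cong (toℚ (+ suc (suc k)) ℚ.*_) (toℚ-N k))))
        (weighted-antitone k)))
    ; vanishes = λ k n≤k → ℤP.+-injective (toℚ-injective (trans (toℚ-N k) (L-vanishes k n≤k)))
    }
    where
    weighted-antitone : ∀ k → toℚ (+ suc k) ℚ.* L (suc k) ℚ.≤ toℚ (+ suc (suc k)) ℚ.* L k
    weighted-antitone k = subst₂ ℚ._≤_
      (solve 3 (λ a b t → (a :* b) :* t := a :* (b :* t)) refl s₁ s₂ (T (suc k)))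
      (solve 3 (λ a b t → (a :* b) :* t := b :* (a :* t)) refl s₁ s₂ (T k))
      (ℚP.*-monoˡ-≤-nonNeg (s₁ ℚ.* s₂) {{ℚ.nonNegative (*-nonNeg (toℚ-pos-nonNeg (suc k)) (toℚ-pos-nonNeg (suc (suc k))))}}
        (tailSum-antitone n coeff coeff-nonNeg k))
      where
      s₁ = toℚ (+ suc k)
      s₂ = toℚ (+ suc (suc k))

  x≗point : x ≗ point n N
  x≗point zero    = toℚ-injective (trans L-height (sym (toℚ-N 0)))
  x≗point (suc j) = toℚ-injective (trans (L-coordinates j)
    (trans (binomialTransform-cong n (sym ∘ toℚ-N) (toℕ j)) (sym (toℚ-point n N j))))

positive-factor : ∀ s a {m} → + suc s ℤ.* + a ≡ + suc m → ∃ λ t → a ≡ suc t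
positive-factor s zero    sa≡1+m = contradiction (trans (sym sa≡1+m) (ℤP.*-zeroʳ (+ suc s))) λ ()
positive-factor s (suc t) _      = t , refl

mainTheorem12 : (n : ℕ) → Normal n
mainTheorem12 n x _ zero () _
mainTheorem12 n x _ (suc s) _ sx∈S = point∈S (proj₁ N0-positive) admissible (proj₂ N0-positive) x≗point
  where
  open FromCone (ConeCombination-unscale s (semigroup⇒ConeCombination sx∈S))
  N0-positive : ∃ λ t → N 0 ≡ suc t
  N0-positive = positive-factor s (N 0)
    (trans (cong (+ suc s ℤ.*_) (sym (x≗point zero))) (proj₂ (semigroup-height sx∈S)))
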